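{- For dual bin packing, Unfair-First-Fit has online bounded ratio $0$.
   Context: Dual bin packing: there are $n$ bins of capacity $1$; items with sizes in $(0,1]$ arrive online and each must be irrevocably either rejected or placed in a bin with enough remaining capacity; the goal is to maximize the number of packed items. Unfair-First-Fit packs items using First-Fit (first bin in a fixed order where the item fits), except that whenever an item larger than $\frac12$ arrives, it rejects the item unless rejecting it would bring the number of items it has accepted below $\frac23$ of the number of items accepted by an optimal offline solution on the prefix of items given so far. For a deterministic online algorithm $A$, $\textsc{Opt}_A$ denotes an offline algorithm that is optimal among offline algorithms whose packing of any input $I$ satisfies, for every prefix $I'$ of $I$, that it packs at least $A(I')$ items of $I'$; the (asymptotic) online bounded ratio of $A$ is the supremum of all $c$ for which there is a constant $\alpha$ with $A(I)\ge c\,\textsc{Opt}_A(I)-\alpha$ for all input sequences $I$. -}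

module Defs where

open import Data.Nat as ℕ using (ℕ; zero; suc; _⊔_)
open import Data.Rational using (ℚ; 0ℚ; 1ℚ; ½; _+_; _<_; _≤_)
open import Data.Rational.Properties using (_≤?_; _<?_)
open import Data.Fin using (Fin) renaming (_≟_ to _≟ᶠ_)
open import Data.Maybe using (Maybe; just; nothing)
open import Data.List using (List; []; _∷_; _++_; [_]; length; map; concatMap; foldr; allFin)
open import Data.List.Relation.Unary.All using (All)
open import Data.Bool using (Bool; true; false; if_then_else_; _∧_)
open import Data.Product using (_×_)
open import Relation.Nullary.Decidable using (does)
open import Relation.Binary.PropositionalEquality using (_≡_)

ValidInput : List ℚ → Set
ValidInput I = All (λ s → (0ℚ < s) × (s ≤ 1ℚ)) I

-- A packing (assignment) of a list of items into n bins:
-- the i-th entry is the bin of the i-th item, or nothing if rejected.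
Assignment : ℕ → Set
Assignment n = List (Maybe (Fin n))

load : ∀ {n} → List ℚ → Assignment n → Fin n → ℚ
load (s ∷ I) (just b′ ∷ A) b = if does (b ≟ᶠ b′) then s + load I A b else load I A b
load (s ∷ I) (nothing ∷ A) b = load I A b
load _ _ _ = 0ℚ

count : ∀ {n} → Assignment n → ℕ
count [] = 0
count (just _ ∷ A) = suc (count A)
count (nothing ∷ A) = count A

Feasible : (n : ℕ) → List ℚ → Assignment n → Set
Feasible n I A = (length A ≡ length I) × (∀ b → load I A b ≤ 1ℚ)

allᵇ : {A : Set} → (A → Bool) → List A → Bool
allᵇ f [] = true
allᵇ f (x ∷ xs) = f x ∧ allᵇ f xs

feasibleᵇ : (n : ℕ) → List ℚ → Assignment n → Bool
feasibleᵇ n I A = allᵇ (λ b → does (load I A b ≤? 1ℚ)) (allFin n)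

assignments : (n k : ℕ) → List (Assignment n)
assignments n zero = [] ∷ []
assignments n (suc k) =
  concatMap (λ A → map (λ d → d ∷ A) (nothing ∷ map just (allFin n))) (assignments n k)

opt : ℕ → List ℚ → ℕ
opt n I = foldr _⊔_ 0 (map (λ A → if feasibleᵇ n I A then count A else 0) (assignments n (length I)))

firstFitIn : ∀ {n} → (Fin n → ℚ) → ℚ → List (Fin n) → Maybe (Fin n)
firstFitIn loads s [] = nothing
firstFitIn loads s (b ∷ bs) = if does (loads b + s ≤? 1ℚ) then just b else firstFitIn loads s bs

firstFit : ∀ {n} → (Fin n → ℚ) → ℚ → Maybe (Fin n)
firstFit {n} loads s = firstFitIn loads s (allFin n)

addTo : ∀ {n} → (Fin n → ℚ) → Maybe (Fin n) → ℚ → (Fin n → ℚ)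
addTo loads nothing s = loads
addTo loads (just b) s = λ b′ → if does (b ≟ᶠ b′) then loads b′ + s else loads b′

-- Unfair-First-Fit, run with current bin loads, number accepted so far,
-- and the prefix seen so far; returns the decisions on the remaining items.
uffGo : (n : ℕ) → (Fin n → ℚ) → ℕ → List ℚ → List ℚ → Assignment n
uffGo n loads acc seen [] = []
uffGo n loads acc seen (s ∷ rest) = d ∷ uffGo n (addTo loads d s) (acc′ d) seen′ rest
  where
  seen′ : List ℚ
  seen′ = seen ++ [ s ]
  -- reject a large item unless rejecting it would make acc < (2/3) opt(seen′)
  rejectLarge : Bool
  rejectLarge = does (½ <? s) ∧ does (2 ℕ.* opt n seen′ ℕ.≤? 3 ℕ.* acc)
  d : Maybe (Fin n)
  d = if rejectLarge then nothing else firstFit loads s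
  acc′ : Maybe (Fin n) → ℕ
  acc′ nothing = acc
  acc′ (just _) = suc acc

uffPacking : (n : ℕ) → List ℚ → Assignment n
uffPacking n I = uffGo n (λ _ → 0ℚ) 0 [] I

uff : ℕ → List ℚ → ℕ
uff n I = count (uffPacking n I)

OptUFFAdmissible : (n : ℕ) → List ℚ → Assignment n → Set
OptUFFAdmissible n I P =
  Feasible n I P × (∀ k → uff n (Data.List.take k I) ℕ.≤ count (Data.List.take k P))

module Submission where

-- We use n = 4 bins and the gadget 1, 1, ¾, 1, ½, ½.  UFF accepts both first
-- 1s, rejects ¾ (it already holds 2 ≥ ⅔·3 items), is then forced to accept the
-- third 1, and puts ½, ½ together: 5 items and every bin completely full.  The
-- packing P keeps ¾ instead of the third 1 and so leaves ¼ free in bin 2.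
-- After the gadget we send k positive items of total size at most ¼
-- ("halvings" of ¼).

open import Defs
open import Data.Nat using (ℕ; zero; suc; _+_; _*_; _<_; _≤_; s≤s; z≤n; >-nonZero)
import Data.Nat.Properties as ℕₚ
import Data.Rational as Q
open import Data.Rational using (ℚ; 0ℚ; 1ℚ; ½)
import Data.Rational.Properties as QP
open import Data.Rational.Properties using (_≤?_; _<?_)
open import Data.Fin using (Fin; zero; suc) renaming (_≟_ to _≟ᶠ_)
open import Data.Maybe using (Maybe; just; nothing)
open import Data.List using (List; []; _∷_; _++_; [_]; length; map; take; foldr; allFin)
import Data.List.Properties as Listₚ
open import Data.List.Relation.Unary.All as All using (All; []; _∷_; all?)
open import Data.List.Relation.Unary.All.Properties using (++⁺; take⁺)
open import Data.Bool using (Bool; true; false; if_then_else_; _∧_)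
open import Data.Product using (Σ; _×_; _,_; proj₁)
open import Function using (const)
open import Relation.Nullary using (¬_; does)
open import Relation.Nullary.Decidable using (toWitness; dec-true; dec-false; _×-dec_)
open import Relation.Binary.PropositionalEquality
  using (_≡_; _≢_; refl; sym; trans; cong; subst; module ≡-Reasoning)

overflow : ∀ {x} → 0ℚ Q.< x → ¬ (1ℚ Q.+ x Q.≤ 1ℚ)
overflow {x} 0<x 1+x≤1 = QP.<-irrefl refl (QP.<-≤-trans 1<1+x 1+x≤1)
  where
  1<1+x : 1ℚ Q.< 1ℚ Q.+ x
  1<1+x = subst (Q._< 1ℚ Q.+ x) (QP.+-identityʳ 1ℚ) (QP.+-monoʳ-< 1ℚ 0<x)

Full : ∀ {n} → (Fin n → ℚ) → Set
Full loads = ∀ b → loads b ≡ 1ℚ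

firstFitIn-full : ∀ {n} {loads : Fin n → ℚ} {x} (bs : List (Fin n)) →
  Full loads → 0ℚ Q.< x → firstFitIn loads x bs ≡ nothing
firstFitIn-full [] full 0<x = refl
firstFitIn-full {loads = loads} {x} (b ∷ bs) full 0<x
  rewrite dec-false (loads b Q.+ x ≤? 1ℚ) (λ fits → overflow 0<x (subst (λ l → l Q.+ x Q.≤ 1ℚ) (full b) fits))
  = firstFitIn-full bs full 0<x

rejectionStays : ∀ {A : Set} (reject : Bool) {d : Maybe A} → d ≡ nothing →
  (if reject then nothing else d) ≡ nothing
rejectionStays true _ = refl
rejectionStays false d≡nothing = d≡nothing

uffGo-full : ∀ {n} (loads : Fin n → ℚ) acc seen (L : List ℚ) →
  Full loads → All (0ℚ Q.<_) L → count (uffGo n loads acc seen L) ≡ 0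
uffGo-full loads acc seen [] full [] = refl
uffGo-full {n} loads acc seen (x ∷ L) full (0<x ∷ pos)
  -- the large-item rule of Defs.uffGo, spelled out
  rewrite rejectionStays (does (½ Q.<? x) ∧ does (2 * opt n (seen ++ [ x ]) ℕₚ.≤? 3 * acc))
            (firstFitIn-full (allFin n) full 0<x)
  = uffGo-full loads acc (seen ++ [ x ]) L full pos

¼ ¾ : ℚ
¼ = ½ Q.* ½
¾ = ½ Q.+ ¼

0<¼ : 0ℚ Q.< ¼
0<¼ = toWitness {a? = 0ℚ <? ¼} _

¼≤1 : ¼ Q.≤ 1ℚ
¼≤1 = toWitness {a? = ¼ ≤? 1ℚ} _

gadget : List ℚ
gadget = 1ℚ ∷ 1ℚ ∷ ¾ ∷ 1ℚ ∷ ½ ∷ ½ ∷ []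

spare : Fin 4
spare = suc (suc zero)

halves : Fin 4
halves = suc (suc (suc zero))

gadgetPacking : Assignment 4
gadgetPacking = just zero ∷ just (suc zero) ∷ just spare ∷ nothing ∷ just halves ∷ just halves ∷ []

-- UFF(gadget ++ L) = 5 for positive items L: its decisions on the six gadget
-- items (including the prefix optima) are computed, leaving all bins full, and
-- afterwards it accepts nothing.
uff-gadget : ∀ L → All (0ℚ Q.<_) L → uff 4 (gadget ++ L) ≡ 5
uff-gadget L pos = cong (5 +_) (uffGo-full _ _ _ L
  (λ { zero → refl ; (suc zero) → refl ; (suc (suc zero)) → refl ; (suc (suc (suc zero))) → refl })
  pos)

halvings : ℕ → ℚ → List ℚ
halvings zero r = []
halvings (suc k) r = ½ Q.* r ∷ halvings k (½ Q.* r)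

length-halvings : ∀ k r → length (halvings k r) ≡ k
length-halvings zero r = refl
length-halvings (suc k) r = cong suc (length-halvings k (½ Q.* r))

halves-sum : ∀ r → ½ Q.* r Q.+ ½ Q.* r ≡ r
halves-sum r = begin
  ½ Q.* r Q.+ ½ Q.* r  ≡⟨ sym (QP.*-distribʳ-+ r ½ ½) ⟩
  (½ Q.+ ½) Q.* r      ≡⟨ QP.*-identityˡ r ⟩
  r                    ∎
  where open ≡-Reasoning

half-pos : ∀ {r} → 0ℚ Q.< r → 0ℚ Q.< ½ Q.* r
half-pos {r} 0<r = QP.positive⁻¹ (½ Q.* r) {{QP.pos*pos⇒pos ½ r {{Q.positive 0<r}}}}

half-≤ : ∀ {r} → 0ℚ Q.< r → ½ Q.* r Q.≤ r
half-≤ {r} 0<r = subst (½ Q.* r Q.≤_) (halves-sum r)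
  (subst (Q._≤ ½ Q.* r Q.+ ½ Q.* r) (QP.+-identityʳ (½ Q.* r))
    (QP.+-monoʳ-≤ (½ Q.* r) (QP.<⇒≤ (half-pos 0<r))))

halvings-bounded : ∀ k {r} → 0ℚ Q.< r → All (λ s → (0ℚ Q.< s) × (s Q.≤ r)) (halvings k r)
halvings-bounded zero 0<r = []
halvings-bounded (suc k) 0<r =
  (half-pos 0<r , half-≤ 0<r)
  ∷ All.map (λ (0<s , s≤½r) → 0<s , QP.≤-trans s≤½r (half-≤ 0<r)) (halvings-bounded k (half-pos 0<r))

sumℚ : List ℚ → ℚ
sumℚ = foldr Q._+_ 0ℚ

sum-halvings : ∀ k {r} → 0ℚ Q.< r → sumℚ (halvings k r) Q.≤ r
sum-halvings zero 0<r = QP.<⇒≤ 0<r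
sum-halvings (suc k) {r} 0<r = subst (sumℚ (halvings (suc k) r) Q.≤_) (halves-sum r)
  (QP.+-monoʳ-≤ (½ Q.* r) (sum-halvings k (half-pos 0<r)))

allInto : ∀ {n} → Fin n → List ℚ → Assignment n
allInto b = map (const (just b))

load-allInto-same : ∀ {n} (b : Fin n) L → load L (allInto b L) b ≡ sumℚ L
load-allInto-same b [] = refl
load-allInto-same b (s ∷ L) rewrite dec-true (b ≟ᶠ b) refl = cong (s Q.+_) (load-allInto-same b L)

load-allInto-other : ∀ {n} {b b′ : Fin n} L → b′ ≢ b → load L (allInto b L) b′ ≡ 0ℚ
load-allInto-other [] _ = refl
load-allInto-other {b = b} {b′} (s ∷ L) b′≢b rewrite dec-false (b′ ≟ᶠ b) b′≢b = load-allInto-other L b′≢b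

count-allInto : ∀ {n} (b : Fin n) L → count (allInto b L) ≡ length L
count-allInto b [] = refl
count-allInto b (s ∷ L) = cong suc (count-allInto b L)

packing : List ℚ → Assignment 4
packing L = gadgetPacking ++ allInto spare L

-- Small items of total size at most ¼ fit next to ¾ in the spare bin; the other
-- bins keep their gadget loads 1, 1 and ½ + ½.
packing-feasible : ∀ L → sumℚ L Q.≤ ¼ → Feasible 4 (gadget ++ L) (packing L)
packing-feasible L small = cong (6 +_) (Listₚ.length-map (const (just spare)) L) , bins
  where
  bins : ∀ b → load (gadget ++ L) (packing L) b Q.≤ 1ℚ
  bins zero = QP.≤-reflexive (cong (1ℚ Q.+_) (load-allInto-other L λ ()))
  bins (suc zero) = QP.≤-reflexive (cong (1ℚ Q.+_) (load-allInto-other L λ ()))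
  bins (suc (suc zero)) =
    QP.+-monoʳ-≤ ¾ (QP.≤-trans (QP.≤-reflexive (load-allInto-same spare L)) small)
  bins (suc (suc (suc zero))) =
    QP.≤-reflexive (cong (λ z → ½ Q.+ (½ Q.+ z)) (load-allInto-other L λ ()))

input-valid : ∀ L → All (λ s → (0ℚ Q.< s) × (s Q.≤ ¼)) L → ValidInput (gadget ++ L)
input-valid L small = ++⁺ gadget-valid (All.map (λ (0<s , s≤¼) → 0<s , QP.≤-trans s≤¼ ¼≤1) small)
  where
  gadget-valid : ValidInput gadget
  gadget-valid = toWitness {a? = all? (λ s → (0ℚ <? s) ×-dec (s ≤? 1ℚ)) gadget} _

-- On every prefix the packing holds at least as many items as UFF: inside the
-- gadget by computation, afterwards because UFF stays at 5.
packing-dominates : ∀ L → All (0ℚ Q.<_) L →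
  ∀ k → uff 4 (take k (gadget ++ L)) ≤ count (take k (packing L))
packing-dominates L pos 0 = ℕₚ.≤ᵇ⇒≤ _ _ _
packing-dominates L pos 1 = ℕₚ.≤ᵇ⇒≤ _ _ _
packing-dominates L pos 2 = ℕₚ.≤ᵇ⇒≤ _ _ _
packing-dominates L pos 3 = ℕₚ.≤ᵇ⇒≤ _ _ _
packing-dominates L pos 4 = ℕₚ.≤ᵇ⇒≤ _ _ _
packing-dominates L pos 5 = ℕₚ.≤ᵇ⇒≤ _ _ _
packing-dominates L pos (suc (suc (suc (suc (suc (suc j)))))) =
  subst (_≤ 5 + count (take j (allInto spare L))) (sym (uff-gadget (take j L) (take⁺ j pos)))
    (ℕₚ.m≤m+n 5 (count (take j (allInto spare L))))

theorem12 : (p q α : ℕ) → 0 < p → 0 < q →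
    Σ ℕ (λ n → Σ (List ℚ) (λ I → ValidInput I ×
      Σ (Assignment n) (λ P → OptUFFAdmissible n I P ×
        (q * (uff n I + α) < p * count P))))
theorem12 p q α 0<p _ =
  4 , gadget ++ tiny , valid , packing tiny , (feasible , dominates) , gap
  where
  k : ℕ
  k = q * (5 + α)

  tiny : List ℚ
  tiny = halvings k ¼

  positive : All (0ℚ Q.<_) tiny
  positive = All.map proj₁ (halvings-bounded k 0<¼)

  valid : ValidInput (gadget ++ tiny)
  valid = input-valid tiny (halvings-bounded k 0<¼)

  feasible : Feasible 4 (gadget ++ tiny) (packing tiny)
  feasible = packing-feasible tiny (sum-halvings k 0<¼)

  dominates : ∀ j → uff 4 (take j (gadget ++ tiny)) ≤ count (take j (packing tiny))
  dominates = packing-dominates tiny positive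

  gap : q * (uff 4 (gadget ++ tiny) + α) < p * count (packing tiny)
  gap = begin-strict
    q * (uff 4 (gadget ++ tiny) + α)  ≡⟨ cong (λ u → q * (u + α)) (uff-gadget tiny positive) ⟩
    k                                 <⟨ ℕₚ.m<n+m k {5} (s≤s z≤n) ⟩
    5 + k                             ≡⟨ cong (5 +_) (sym (trans (count-allInto spare tiny) (length-halvings k ¼))) ⟩
    count (packing tiny)              ≤⟨ ℕₚ.m≤n*m (count (packing tiny)) p {{>-nonZero 0<p}} ⟩
    p * count (packing tiny)          ∎
    where open ℕₚ.≤-Reasoning
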